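{- Let $\mathfrak{g}$ be of type $E_8^{(1)}$ and $s\ge1$. Let $\alpha = 2\alpha_1+3\alpha_2+4\alpha_3+6\alpha_4+5\alpha_5+4\alpha_6+3\alpha_7+2\alpha_8 = \Lambda_8$. Then the highest weight rigged configurations of $B^{8,s}$ are exactly $\nu(k\ast[\alpha])$, $0\le k\le s$, with all riggings $0$; the one indexed by $k$ has weight $(s-k)\Lambda_8$ and cocharge $k$. Consequently \[ \mathrm{RC}(B^{8,s}) = \bigoplus_{k=0}^s \mathrm{RC}(B^{8,s}; (s-k)\Lambda_8). \]
   Context: Finite type $E_8$ with Bourbaki labeling: edges $1$–$3$, $3$–$4$, $4$–$5$, $5$–$6$, $6$–$7$, $7$–$8$, $2$–$4$; $I_0=\{1,\dots,8\}$, Cartan matrix $(A_{ab})$, simple roots $\alpha_a$, fundamental weights $\Lambda_a$. Rigged configurations for $B^{r,s}$: a configuration $\nu=(\nu^{(a)})_{a\in I_0}$ is a tuple of partitions, $m_i^{(a)}$ the number of rows of length $i$ in $\nu^{(a)}$. Vacancy numbers: $p_i^{(a)} = \delta_{ar}\min(i,s) - \sum_{b\in I_0}A_{ab}\sum_{j\ge1}\min(i,j)m_j^{(b)}$. A rigged configuration $(\nu,J)$ assigns to each row of $\nu^{(a)}$ of length $i$ an integer rigging $x\le p_i^{(a)}$ (a multiset for rows of equal length); it is highest weight if all riggings are $\ge 0$. Weight: $s\Lambda_r-\sum_a|\nu^{(a)}|\alpha_a$. Cocharge: $\mathrm{cc}(\nu,J)=\frac12\sum_{a,b\in I_0}\sum_{i,j}A_{ab}\min(i,j)m_i^{(a)}m_j^{(b)}+\sum(\text{all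 riggings})$. $\mathrm{RC}(B^{r,s})$ is a $U_q(\mathfrak{g}_0)$-crystal whose highest weight elements are the highest weight rigged configurations, each of weight $\lambda$ generating a component isomorphic to $B(\lambda)$; $\mathrm{RC}(B^{r,s};\lambda)$ is the union of components with highest weight $\lambda$. For $\beta^{(k)}=\sum_a c_a^{(k)}\alpha_a$ with $c_a^{(k)}\in\mathbb{Z}_{\ge0}$, $\nu(\beta^{(1)},\dots,\beta^{(\ell)})$ is the configuration in which $\nu^{(a)}$ has columns of heights $c_a^{(1)},\dots,c_a^{(\ell)}$ (sorted, zeros omitted); $k\ast[\beta]$ is $k$ copies of $\beta$. -}

module Defs where

open import Data.Nat as ℕ using (ℕ; zero; suc)
open import Data.Integer as ℤ using (ℤ; +_; _-_; _/ℕ_)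
open import Data.Fin using (Fin; toℕ; fromℕ)
open import Data.Vec using (Vec; lookup; tabulate; _∷_; [])
open import Data.List using (List; map; foldr; replicate; length; concatMap; allFin)
open import Data.List.Relation.Unary.All using (All)
open import Data.List.Relation.Unary.Linked using (Linked)
open import Data.Product using (_×_; _,_; proj₁; proj₂)
open import Data.Sum using (_⊎_)
open import Relation.Binary.PropositionalEquality using (_≡_)

-- Nodes of E_8: Fin 8, where Fin index i corresponds to Bourbaki label i+1.
Node : Set
Node = Fin 8

adjℕ : ℕ → ℕ → ℕ
adjℕ 0 2 = 1
adjℕ 2 0 = 1
adjℕ 2 3 = 1
adjℕ 3 2 = 1
adjℕ 3 4 = 1
adjℕ 4 3 = 1
adjℕ 4 5 = 1
adjℕ 5 4 = 1
adjℕ 5 6 = 1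
adjℕ 6 5 = 1
adjℕ 6 7 = 1
adjℕ 7 6 = 1
adjℕ 1 3 = 1
adjℕ 3 1 = 1
adjℕ _ _ = 0

δℕ : ℕ → ℕ → ℕ
δℕ zero zero = 1
δℕ zero (suc n) = 0
δℕ (suc m) zero = 0
δℕ (suc m) (suc n) = δℕ m n

cartan : Node → Node → ℤ
cartan a b = (+ (2 ℕ.* δℕ (toℕ a) (toℕ b))) - (+ adjℕ (toℕ a) (toℕ b))

δ : Node → Node → ℤ
δ a b = + δℕ (toℕ a) (toℕ b)

node8 : Node
node8 = fromℕ 7

sumℤ : List ℤ → ℤ
sumℤ = foldr ℤ._+_ (+ 0)

Σnodes : (Node → ℤ) → ℤ
Σnodes f = sumℤ (map f (allFin 8))

-- A row of a rigged partition: (row length, rigging).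
Row : Set
Row = ℕ × ℤ

RC : Set
RC = Vec (List Row) 8

-- Canonical form (so that equal rigged configurations are equal lists):
-- every row has positive length, and rows are listed in non-increasing
-- lexicographic order of (length, rigging); the multiset of riggings on
-- rows of equal length is thus listed in non-increasing order.
RowGeq : Row → Row → Set
RowGeq (i , x) (j , y) = (j ℕ.< i) ⊎ ((j ≡ i) × (y ℤ.≤ x))

Canonical : RC → Set
Canonical rc = (a : Node) →
  All (λ r → 1 ℕ.≤ proj₁ r) (lookup rc a) × Linked RowGeq (lookup rc a)

size : List Row → ℕ
size rows = foldr ℕ._+_ 0 (map proj₁ rows)

Qmin : ℕ → List Row → ℕ
Qmin i rows = foldr ℕ._+_ 0 (map (λ r → ℕ._⊓_ i (proj₁ r)) rows)

vacancy : ℕ → RC → Node → ℕ → ℤ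
vacancy s rc a i =
  (δ a node8 ℤ.* (+ (ℕ._⊓_ i s)))
    - Σnodes (λ b → cartan a b ℤ.* (+ Qmin i (lookup rc b)))

IsHWRC : ℕ → RC → Set
IsHWRC s rc = (a : Node) →
  All (λ r → (+ 0 ℤ.≤ proj₂ r) × (proj₂ r ℤ.≤ vacancy s rc a (proj₁ r)))
      (lookup rc a)

-- Weight s Λ_8 - Σ_a |ν^(a)| α_a, written in the basis of fundamental
-- weights (α_a = Σ_b A_{ba} Λ_b): component at b.
weight : ℕ → RC → Vec ℤ 8
weight s rc = tabulate λ b →
  (δ b node8 ℤ.* (+ s)) - Σnodes (λ a → cartan b a ℤ.* (+ size (lookup rc a)))

nΛ8 : ℕ → Vec ℤ 8
nΛ8 n = tabulate λ b → δ b node8 ℤ.* (+ n)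

pairMin : List Row → List Row → ℕ
pairMin xs ys = foldr ℕ._+_ 0 (map (λ r → Qmin (proj₁ r) ys) xs)

-- Cocharge: (1/2) Σ_{a,b} A_ab Σ_{i,j} min(i,j) m_i^(a) m_j^(b) + Σ riggings.
-- (The quadratic sum is always even; we divide by 2 with integer division.)
cocharge : RC → ℤ
cocharge rc =
  (Σnodes (λ a → Σnodes (λ b →
      cartan a b ℤ.* (+ pairMin (lookup rc a) (lookup rc b))))) /ℕ 2
  ℤ.+ Σnodes (λ a → sumℤ (map proj₂ (lookup rc a)))

αcoef : Node → ℕ
αcoef a = lookup (2 ∷ 3 ∷ 4 ∷ 6 ∷ 5 ∷ 4 ∷ 3 ∷ 2 ∷ []) a

-- ν(k∗[α]) with all riggings 0: ν^(a) has k columns of height c_a,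
-- i.e. c_a rows of length k (empty if k = 0).
columnsRows : ℕ → ℕ → List Row
columnsRows zero c = Data.List.[]
columnsRows (suc k) c = replicate c (suc k , + 0)

νkα : ℕ → RC
νkα k = tabulate λ a → columnsRows k (αcoef a)

-- Let ν be highest weight. Summing 0 ≤ x ≤ p_i^(a) over all rows gives
-- 0 ≤ Σ riggings ≤ Σ_rows p_i^(a). Cutting ν into columns, with h_c ∈ ℕ⁸ the heights of the
-- c-th columns of the ν^(a), min(i, j) counts the columns shared by rows of lengths i and j, so
-- the right-hand side is -Σ_c ((h_c, h_c) - [c ≤ s] (h_c)₈), where (·,·) is the E₈ Cartan form.
-- On the E₈ root lattice (x, x) ≥ x₈ = (x, θ), with equality only for x = 0 and x = θ (θ = α of
-- the statement): writing x₁ = 2m or 2m + 1, (x, x) - x₈ is a sum of squares and of products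
-- b(b - 1) of consecutive integers, plus 1 when x₁ is odd. Hence all riggings vanish and every
-- column is 0 or θ, the nonzero ones among the first s: ν = ν(k∗[θ]) with k ≤ s.
module Submission where

module Sums where

  open import Data.Nat as ℕ using (ℕ)
  import Data.Nat.Properties as ℕ
  open import Data.Integer
  open import Data.Integer.Properties
  open import Data.Integer.Tactic.RingSolver using (solve-∀)
  open import Data.List using ([]; _∷_; map; foldr)
  open import Data.List.Membership.Propositional using (_∈_)
  open import Data.List.Relation.Unary.All using (All; []; _∷_)
  open import Data.List.Relation.Unary.Any using (here; there)
  open import Data.Product using (_×_; _,_)
  open import Relation.Binary.PropositionalEquality
  open import Defs using (sumℤ)

  nonneg-+≡0 : ∀ {i j} → + 0 ≤ i → + 0 ≤ j → i + j ≡ + 0 → i ≡ + 0 × j ≡ + 0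
  nonneg-+≡0 {i} {j} 0≤i 0≤j i+j≡0 =
    i≡0 , trans (sym (+-identityˡ j)) (subst (λ k → k + j ≡ + 0) i≡0 i+j≡0)
    where
    i≡0 : i ≡ + 0
    i≡0 = ≤-antisym (subst (i ≤_) i+j≡0 (i≤i+j i j {{nonNegative 0≤j}})) 0≤i

  module _ {A : Set} where

    sumℤ-map-nonneg : ∀ {f : A → ℤ} {xs} → All (λ x → + 0 ≤ f x) xs → + 0 ≤ sumℤ (map f xs)
    sumℤ-map-nonneg [] = ≤-refl
    sumℤ-map-nonneg (0≤fx ∷ 0≤fxs) = +-mono-≤ 0≤fx (sumℤ-map-nonneg 0≤fxs)

    sumℤ-map≡0 : ∀ {f : A → ℤ} {xs} → All (λ x → + 0 ≤ f x) xs → sumℤ (map f xs) ≡ + 0 →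
                 All (λ x → f x ≡ + 0) xs
    sumℤ-map≡0 [] _ = []
    sumℤ-map≡0 (0≤fx ∷ 0≤fxs) sum≡0 with nonneg-+≡0 0≤fx (sumℤ-map-nonneg 0≤fxs) sum≡0
    ... | fx≡0 , rest≡0 = fx≡0 ∷ sumℤ-map≡0 0≤fxs rest≡0

    sumℤ-map-mono : ∀ {f g : A → ℤ} {xs} → All (λ x → f x ≤ g x) xs →
                    sumℤ (map f xs) ≤ sumℤ (map g xs)
    sumℤ-map-mono [] = ≤-refl
    sumℤ-map-mono (fx≤gx ∷ fxs≤gxs) = +-mono-≤ fx≤gx (sumℤ-map-mono fxs≤gxs)

    sumℤ-map-+ : ∀ (f g : A → ℤ) xs →
                 sumℤ (map (λ x → f x + g x) xs) ≡ sumℤ (map f xs) + sumℤ (map g xs)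
    sumℤ-map-+ f g [] = refl
    sumℤ-map-+ f g (x ∷ xs) =
      trans (cong (_+_ (f x + g x)) (sumℤ-map-+ f g xs))
            (interchange (f x) (g x) (sumℤ (map f xs)) (sumℤ (map g xs)))
      where
      interchange : ∀ a b c d → a + b + (c + d) ≡ a + c + (b + d)
      interchange = solve-∀

    sumℤ-map-- : ∀ (f g : A → ℤ) xs →
                 sumℤ (map (λ x → f x - g x) xs) ≡ sumℤ (map f xs) - sumℤ (map g xs)
    sumℤ-map-- f g [] = refl
    sumℤ-map-- f g (x ∷ xs) =
      trans (cong (_+_ (f x - g x)) (sumℤ-map-- f g xs))
            (interchange (f x) (g x) (sumℤ (map f xs)) (sumℤ (map g xs)))
      where
      interchange : ∀ a b c d → a - b + (c - d) ≡ a + c - (b + d)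
      interchange = solve-∀

    sumℤ-map-*ˡ : ∀ c (f : A → ℤ) xs → sumℤ (map (λ x → c * f x) xs) ≡ c * sumℤ (map f xs)
    sumℤ-map-*ˡ c f [] = sym (*-zeroʳ c)
    sumℤ-map-*ˡ c f (x ∷ xs) =
      trans (cong (_+_ (c * f x)) (sumℤ-map-*ˡ c f xs)) (sym (*-distribˡ-+ c (f x) (sumℤ (map f xs))))

    sumℤ-map-*ʳ : ∀ c (f : A → ℤ) xs → sumℤ (map (λ x → f x * c) xs) ≡ sumℤ (map f xs) * c
    sumℤ-map-*ʳ c f [] = refl
    sumℤ-map-*ʳ c f (x ∷ xs) =
      trans (cong (_+_ (f x * c)) (sumℤ-map-*ʳ c f xs)) (sym (*-distribʳ-+ c (f x) (sumℤ (map f xs))))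

    pos-sum : ∀ (f : A → ℕ) xs → + foldr ℕ._+_ 0 (map f xs) ≡ sumℤ (map (λ x → + f x) xs)
    pos-sum f [] = refl
    pos-sum f (x ∷ xs) = trans (pos-+ (f x) _) (cong (_+_ (+ f x)) (pos-sum f xs))

    ∈⇒≤sum : ∀ (f : A → ℕ) {x xs} → x ∈ xs → f x ℕ.≤ foldr ℕ._+_ 0 (map f xs)
    ∈⇒≤sum f (here refl) = ℕ.m≤m+n _ _
    ∈⇒≤sum f {xs = y ∷ _} (there x∈xs) = ℕ.≤-trans (∈⇒≤sum f x∈xs) (ℕ.m≤n+m _ (f y))

  module _ {A B : Set} where

    sumℤ-map-swap : ∀ (f : A → B → ℤ) xs ys →
      sumℤ (map (λ x → sumℤ (map (f x) ys)) xs) ≡ sumℤ (map (λ y → sumℤ (map (λ x → f x y) xs)) ys)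
    sumℤ-map-swap f [] ys = sym (zeros ys)
      where
      zeros : ∀ ys → sumℤ (map (λ (_ : B) → + 0) ys) ≡ + 0
      zeros [] = refl
      zeros (_ ∷ ys) = trans (+-identityˡ _) (zeros ys)
    sumℤ-map-swap f (x ∷ xs) ys =
      trans (cong (_+_ (sumℤ (map (f x) ys))) (sumℤ-map-swap f xs ys))
            (sym (sumℤ-map-+ (f x) (λ y → sumℤ (map (λ x′ → f x′ y) xs)) ys))

module E8Form where

  open import Data.Nat as ℕ using (ℕ)
  import Data.Nat.Properties as ℕ
  open import Data.Integer
  open import Data.Integer.Properties
  open import Data.Integer.DivMod using (_%ℕ_; _/ℕ_; n%ℕd<d; a≡a%ℕn+[a/ℕn]*n)
  open import Data.Integer.Tactic.RingSolver using (solve-∀)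
  open import Data.Integer.Solver using (module +-*-Solver)
  open +-*-Solver using (solve; _:=_; _:+_; _:*_; _:-_; con; Polynomial)
  open import Data.Fin using (#_)
  open import Data.Vec using (Vec; lookup; tabulate; _∷_; [])
  open import Data.Vec.Properties using (lookup∘tabulate)
  open import Data.List using (List; _∷_; []; foldr; map; allFin)
  open import Data.List.Relation.Unary.All as All using (All; _∷_; [])
  open import Data.Product using (_×_; _,_; uncurry)
  open import Data.Sum as Sum using (_⊎_; inj₁; inj₂; [_,_]′)
  open import Data.Empty using (⊥-elim)
  open import Function using (id)
  open import Relation.Nullary using (¬_)
  open import Relation.Binary.PropositionalEquality
  open import Defs
  open Sums

  square pronic : ℤ → ℤ
  square i = i * i
  pronic i = i * (i - + 1)

  square-nonneg : ∀ i → + 0 ≤ square i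
  square-nonneg (+ n) = subst (+ 0 ≤_) (pos-* n n) (+≤+ ℕ.z≤n)
  square-nonneg -[1+ n ] = +≤+ ℕ.z≤n

  pronic-nonneg : ∀ i → + 0 ≤ pronic i
  pronic-nonneg (+ 0) = +≤+ ℕ.z≤n
  pronic-nonneg +[1+ n ] = subst (+ 0 ≤_) (pos-* (ℕ.suc n) n) (+≤+ ℕ.z≤n)
  pronic-nonneg -[1+ n ] = +≤+ ℕ.z≤n

  square≡0 : ∀ i → square i ≡ + 0 → i ≡ + 0
  square≡0 i i²≡0 = [ id , id ]′ (i*j≡0⇒i≡0∨j≡0 i i²≡0)

  pronic≡0 : ∀ i → pronic i ≡ + 0 → i ≡ + 0 ⊎ i ≡ + 1
  pronic≡0 i p = Sum.map₂ (i-j≡0⇒i≡j i (+ 1)) (i*j≡0⇒i≡0∨j≡0 i p)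

  2*i≢1 : ∀ i → + 2 * i ≢ + 1
  2*i≢1 i 2i≡1 = ℕ.even≢odd ∣ i ∣ 0 (trans (sym (abs-* (+ 2) i)) (cong ∣_∣ 2i≡1))

  pronic[2j+m]≡0 : ∀ j m → pronic (+ 2 * j + m) ≡ + 0 → pronic m ≡ + 0 → j ≡ + 0
  pronic[2j+m]≡0 j m p pm with i*j≡0⇒i≡0∨j≡0 (+ 2 * j) (begin
      + 2 * j * (+ 2 * (j + m) - + 1)   ≡⟨ difference j m ⟩
      pronic (+ 2 * j + m) - pronic m   ≡⟨ cong₂ _-_ p pm ⟩
      + 0                               ∎)
    where
    open ≡-Reasoning
    difference : ∀ j m →
      + 2 * j * (+ 2 * (j + m) - + 1) ≡ (+ 2 * j + m) * (+ 2 * j + m - + 1) - m * (m - + 1)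
    difference = solve-∀
  ... | inj₁ 2j≡0 = [ (λ ()) , id ]′ (i*j≡0⇒i≡0∨j≡0 (+ 2) 2j≡0)
  ... | inj₂ 2[j+m]-1≡0 = ⊥-elim (2*i≢1 (j + m) (i-j≡0⇒i≡j _ _ 2[j+m]-1≡0))

  data Parity : ℤ → Set where
    even : ∀ m → Parity (+ 2 * m)
    odd  : ∀ m → Parity (+ 2 * m + + 1)

  parity : ∀ i → Parity i
  parity i =
    subst Parity (sym (a≡a%ℕn+[a/ℕn]*n i 2)) (remainder-parity (i %ℕ 2) (i /ℕ 2) (n%ℕd<d i 2))
    where
    remainder-parity : ∀ r q → r ℕ.< 2 → Parity (+ r + q * + 2)
    remainder-parity 0 q _ = subst Parity (even-form q) (even q)
      where
      even-form : ∀ q → + 2 * q ≡ + 0 + q * + 2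
      even-form = solve-∀
    remainder-parity 1 q _ = subst Parity (odd-form q) (odd q)
      where
      odd-form : ∀ q → + 2 * q + + 1 ≡ + 1 + q * + 2
      odd-form = solve-∀
    remainder-parity (ℕ.suc (ℕ.suc _)) _ (ℕ.s≤s (ℕ.s≤s ()))

  cartanForm : (Node → ℤ) → ℤ
  cartanForm x = Σnodes λ a → Σnodes λ b → cartan a b * (x a * x b)

  sumSquaresPronics : List ℤ → List ℤ → ℤ
  sumSquaresPronics as bs = sumℤ (map square as) + sumℤ (map pronic bs)

  sumSquaresPronics-nonneg : ∀ as bs → + 0 ≤ sumSquaresPronics as bs
  sumSquaresPronics-nonneg as bs = +-mono-≤ (sumℤ-map-nonneg (All.universal square-nonneg as))
                                            (sumℤ-map-nonneg (All.universal pronic-nonneg bs))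

  sumSquaresPronics≡0 : ∀ as bs → sumSquaresPronics as bs ≡ + 0 →
                        All (_≡ + 0) as × All (λ b → pronic b ≡ + 0) bs
  sumSquaresPronics≡0 as bs sum≡0
    with nonneg-+≡0 (sumℤ-map-nonneg (All.universal square-nonneg as))
                    (sumℤ-map-nonneg (All.universal pronic-nonneg bs)) sum≡0
  ... | squares≡0 , pronics≡0 =
    All.map (λ {a} → square≡0 a) (sumℤ-map≡0 (All.universal square-nonneg as) squares≡0) ,
    sumℤ-map≡0 (All.universal pronic-nonneg bs) pronics≡0

  evenSquares oddPronics : ℤ → ℤ → ℤ → ℤ → ℤ → ℤ → ℤ → ℤ → List ℤ
  evenSquares m x₂ x₃ x₄ x₅ x₆ x₇ x₈ =
    x₃ - (m + x₂) ∷ x₄ - (x₂ + x₃ - m) ∷ x₅ - (x₄ - m) ∷ x₆ - (x₅ - m) ∷ x₇ - (x₆ - m) ∷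
    x₈ - (x₇ - m) ∷ []
  oddPronics m x₂ x₃ x₄ x₅ x₆ x₇ x₈ =
    x₃ - (m + x₂) ∷ x₂ + x₃ - m - x₄ ∷ x₄ - m - x₅ ∷ x₅ - m - x₆ ∷ x₆ - m - x₇ ∷ x₇ - m - x₈ ∷ []

  -- Polynomial mirrors of Σnodes, cartanForm and sumSquaresPronics: their semantics unfold to
  -- those functions, so the ring solver can check identities stated about cartanForm itself.
  module _ {n : ℕ} where

    ΣnodesS : (Node → Polynomial n) → Polynomial n
    ΣnodesS f = foldr _:+_ (con (+ 0)) (map f (allFin 8))

    cartanFormS : (Node → Polynomial n) → Polynomial n
    cartanFormS x = ΣnodesS λ a → ΣnodesS λ b → con (cartan a b) :* (x a :* x b)

    sumSquaresPronicsS : List (Polynomial n) → List (Polynomial n) → Polynomial n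
    sumSquaresPronicsS as bs = foldr _:+_ (con (+ 0)) (map (λ p → p :* p) as)
                               :+ foldr _:+_ (con (+ 0)) (map (λ p → p :* (p :- con (+ 1))) bs)

  cartanForm-even : ∀ m x₂ x₃ x₄ x₅ x₆ x₇ x₈ →
    cartanForm (lookup (+ 2 * m ∷ x₂ ∷ x₃ ∷ x₄ ∷ x₅ ∷ x₆ ∷ x₇ ∷ x₈ ∷ [])) - x₈ ≡
    sumSquaresPronics (evenSquares m x₂ x₃ x₄ x₅ x₆ x₇ x₈) (x₈ - m ∷ m ∷ [])
  cartanForm-even = solve 8 (λ m x₂ x₃ x₄ x₅ x₆ x₇ x₈ →
    cartanFormS (lookup (con (+ 2) :* m ∷ x₂ ∷ x₃ ∷ x₄ ∷ x₅ ∷ x₆ ∷ x₇ ∷ x₈ ∷ [])) :- x₈ :=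
    sumSquaresPronicsS
      (x₃ :- (m :+ x₂) ∷ x₄ :- (x₂ :+ x₃ :- m) ∷ x₅ :- (x₄ :- m) ∷ x₆ :- (x₅ :- m) ∷
       x₇ :- (x₆ :- m) ∷ x₈ :- (x₇ :- m) ∷ [])
      (x₈ :- m ∷ m ∷ [])) refl

  cartanForm-odd : ∀ m x₂ x₃ x₄ x₅ x₆ x₇ x₈ →
    cartanForm (lookup (+ 2 * m + + 1 ∷ x₂ ∷ x₃ ∷ x₄ ∷ x₅ ∷ x₆ ∷ x₇ ∷ x₈ ∷ [])) - x₈ - + 1 ≡
    sumSquaresPronics (x₈ - m - + 1 ∷ m ∷ []) (oddPronics m x₂ x₃ x₄ x₅ x₆ x₇ x₈)
  cartanForm-odd = solve 8 (λ m x₂ x₃ x₄ x₅ x₆ x₇ x₈ →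
    cartanFormS (lookup (con (+ 2) :* m :+ con (+ 1) ∷ x₂ ∷ x₃ ∷ x₄ ∷ x₅ ∷ x₆ ∷ x₇ ∷ x₈ ∷ []))
      :- x₈ :- con (+ 1) :=
    sumSquaresPronicsS
      (x₈ :- m :- con (+ 1) ∷ m ∷ [])
      (x₃ :- (m :+ x₂) ∷ x₂ :+ x₃ :- m :- x₄ ∷ x₄ :- m :- x₅ ∷ x₅ :- m :- x₆ ∷
       x₆ :- m :- x₇ ∷ x₇ :- m :- x₈ ∷ [])) refl

  ZeroOrθ : Vec ℤ 8 → Set
  ZeroOrθ v = v ≡ tabulate (λ _ → + 0) ⊎ v ≡ tabulate (λ a → + αcoef a)

  -- The argument of pronic is x₈ - m once evenSquares ≡ 0 has been solved for x₃, …, x₈.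
  x₂≡3m : ∀ m x₂ → pronic (x₂ + (m + x₂) - m - m - m - m - m - m) ≡ + 0 → pronic m ≡ + 0 →
          x₂ ≡ + 3 * m
  x₂≡3m m x₂ p pm = i-j≡0⇒i≡j x₂ (+ 3 * m)
    (pronic[2j+m]≡0 (x₂ - + 3 * m) m (subst (λ k → pronic k ≡ + 0) (regroup m x₂) p) pm)
    where
    regroup : ∀ m x₂ → x₂ + (m + x₂) - m - m - m - m - m - m ≡ + 2 * (x₂ - + 3 * m) + m
    regroup = solve-∀

  evenSquares≡0⇒ZeroOrθ : ∀ m x₂ x₃ x₄ x₅ x₆ x₇ x₈ →
    All (_≡ + 0) (evenSquares m x₂ x₃ x₄ x₅ x₆ x₇ x₈) → All (λ b → pronic b ≡ + 0) (x₈ - m ∷ m ∷ []) →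
    ZeroOrθ (+ 2 * m ∷ x₂ ∷ x₃ ∷ x₄ ∷ x₅ ∷ x₆ ∷ x₇ ∷ x₈ ∷ [])
  evenSquares≡0⇒ZeroOrθ m x₂ x₃ x₄ x₅ x₆ x₇ x₈ (e₃ ∷ e₄ ∷ e₅ ∷ e₆ ∷ e₇ ∷ e₈ ∷ []) (p₈ ∷ pm ∷ [])
    with i-j≡0⇒i≡j x₃ _ e₃ | i-j≡0⇒i≡j x₄ _ e₄ | i-j≡0⇒i≡j x₅ _ e₅
       | i-j≡0⇒i≡j x₆ _ e₆ | i-j≡0⇒i≡j x₇ _ e₇ | i-j≡0⇒i≡j x₈ _ e₈
  ... | refl | refl | refl | refl | refl | refl with x₂≡3m m x₂ p₈ pm | pronic≡0 m pm
  ... | refl | inj₁ refl = inj₁ refl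
  ... | refl | inj₂ refl = inj₂ refl

  private
    module _ (x₁ x₂ x₃ x₄ x₅ x₆ x₇ x₈ : ℤ) where

      x₈≤cartanForm : x₈ ≤ cartanForm (lookup (x₁ ∷ x₂ ∷ x₃ ∷ x₄ ∷ x₅ ∷ x₆ ∷ x₇ ∷ x₈ ∷ []))
      x₈≤cartanForm with parity x₁
      ... | even m = 0≤i-j⇒j≤i (subst (+ 0 ≤_) (sym (cartanForm-even m x₂ x₃ x₄ x₅ x₆ x₇ x₈))
        (sumSquaresPronics-nonneg (evenSquares m x₂ x₃ x₄ x₅ x₆ x₇ x₈) (x₈ - m ∷ m ∷ [])))
      ... | odd m = 0≤i-j⇒j≤i (≤-trans (+≤+ ℕ.z≤n) (0≤i-j⇒j≤i
        (subst (+ 0 ≤_) (sym (cartanForm-odd m x₂ x₃ x₄ x₅ x₆ x₇ x₈))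
          (sumSquaresPronics-nonneg (x₈ - m - + 1 ∷ m ∷ []) (oddPronics m x₂ x₃ x₄ x₅ x₆ x₇ x₈)))))

      cartanForm≡x₈⇒ZeroOrθ : cartanForm (lookup (x₁ ∷ x₂ ∷ x₃ ∷ x₄ ∷ x₅ ∷ x₆ ∷ x₇ ∷ x₈ ∷ [])) ≡ x₈ →
                              ZeroOrθ (x₁ ∷ x₂ ∷ x₃ ∷ x₄ ∷ x₅ ∷ x₆ ∷ x₇ ∷ x₈ ∷ [])
      cartanForm≡x₈⇒ZeroOrθ q≡x₈ with parity x₁
      ... | even m = uncurry (evenSquares≡0⇒ZeroOrθ m x₂ x₃ x₄ x₅ x₆ x₇ x₈)
        (sumSquaresPronics≡0 (evenSquares m x₂ x₃ x₄ x₅ x₆ x₇ x₈) (x₈ - m ∷ m ∷ [])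
          (trans (sym (cartanForm-even m x₂ x₃ x₄ x₅ x₆ x₇ x₈)) (i≡j⇒i-j≡0 q≡x₈)))
      ... | odd m = ⊥-elim (+0≰-1 (subst (+ 0 ≤_) sum≡-1
        (sumSquaresPronics-nonneg (x₈ - m - + 1 ∷ m ∷ []) (oddPronics m x₂ x₃ x₄ x₅ x₆ x₇ x₈))))
        where
        sum≡-1 : sumSquaresPronics (x₈ - m - + 1 ∷ m ∷ []) (oddPronics m x₂ x₃ x₄ x₅ x₆ x₇ x₈) ≡ -[1+ 0 ]
        sum≡-1 = trans (sym (cartanForm-odd m x₂ x₃ x₄ x₅ x₆ x₇ x₈)) (cong (_- + 1) (i≡j⇒i-j≡0 q≡x₈))
        +0≰-1 : ¬ (+ 0 ≤ -[1+ 0 ])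
        +0≰-1 ()

  tabulate-injective : ∀ {A : Set} {f g : Node → A} → tabulate f ≡ tabulate g → ∀ a → f a ≡ g a
  tabulate-injective {f = f} {g} f≡g a =
    trans (sym (lookup∘tabulate f a)) (trans (cong (λ v → lookup v a) f≡g) (lookup∘tabulate g a))

  node8≤cartanForm : ∀ x → x node8 ≤ cartanForm x
  node8≤cartanForm x =
    x₈≤cartanForm (x (# 0)) (x (# 1)) (x (# 2)) (x (# 3)) (x (# 4)) (x (# 5)) (x (# 6)) (x (# 7))

  cartanForm≡node8⇒0⊎θ : ∀ x → cartanForm x ≡ x node8 → (∀ a → x a ≡ + 0) ⊎ (∀ a → x a ≡ + αcoef a)
  cartanForm≡node8⇒0⊎θ x q≡x₈ = Sum.map tabulate-injective tabulate-injective
    (cartanForm≡x₈⇒ZeroOrθ (x (# 0)) (x (# 1)) (x (# 2)) (x (# 3)) (x (# 4)) (x (# 5)) (x (# 6)) (x (# 7))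
                            q≡x₈)

  Σnodes-δ8 : ∀ (f : Node → ℤ) → Σnodes (λ a → δ a node8 * f a) ≡ f node8
  Σnodes-δ8 f = pick (f (# 0)) (f (# 1)) (f (# 2)) (f (# 3)) (f (# 4)) (f (# 5)) (f (# 6)) (f (# 7))
    where
    pick : ∀ x₁ x₂ x₃ x₄ x₅ x₆ x₇ x₈ →
      Σnodes (λ a → δ a node8 * lookup (x₁ ∷ x₂ ∷ x₃ ∷ x₄ ∷ x₅ ∷ x₆ ∷ x₇ ∷ x₈ ∷ []) a) ≡ x₈
    pick = solve 8 (λ x₁ x₂ x₃ x₄ x₅ x₆ x₇ x₈ →
      ΣnodesS (λ a → con (δ a node8) :* lookup (x₁ ∷ x₂ ∷ x₃ ∷ x₄ ∷ x₅ ∷ x₆ ∷ x₇ ∷ x₈ ∷ []) a) := x₈) refl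

  cartan-θ : ∀ a → Σnodes (λ b → cartan a b * + αcoef b) ≡ δ a node8
  cartan-θ = tabulate-injective refl

module Columns where

  open import Data.Nat
  open import Data.Nat.Properties
  open import Data.Nat.Tactic.RingSolver using (solve-∀)
  open import Data.Integer using (0ℤ)
  open import Data.List using (List; []; _∷_; length)
  open import Data.List.Properties using (length-replicate; ∷-injective)
  open import Data.List.Relation.Unary.All using (All; []; _∷_)
  open import Data.Product using (_,_; proj₁; proj₂)
  open import Data.Empty using (⊥-elim)
  open import Relation.Binary.PropositionalEquality
  open import Defs using (Row; Qmin; pairMin; columnsRows)

  PositiveRow UnriggedRow : Row → Set
  PositiveRow r = 1 ≤ proj₁ r
  UnriggedRow r = proj₂ r ≡ 0ℤ

  BoundedRow : ℕ → Row → Set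
  BoundedRow N r = proj₁ r ≤ N

  height : List Row → ℕ
  height [] = 0
  height ((zero , _) ∷ rows) = height rows
  height ((suc _ , _) ∷ rows) = suc (height rows)

  dropColumn : List Row → List Row
  dropColumn [] = []
  dropColumn ((zero , _) ∷ rows) = dropColumn rows
  dropColumn ((suc zero , _) ∷ rows) = dropColumn rows
  dropColumn ((suc (suc i) , x) ∷ rows) = (suc i , x) ∷ dropColumn rows

  Qmin-zero : ∀ rows → Qmin 0 rows ≡ 0
  Qmin-zero [] = refl
  Qmin-zero (_ ∷ rows) = Qmin-zero rows

  Qmin-suc : ∀ i rows → Qmin (suc i) rows ≡ height rows + Qmin i (dropColumn rows)
  Qmin-suc i [] = refl
  Qmin-suc i ((zero , _) ∷ rows) = Qmin-suc i rows
  Qmin-suc i ((suc zero , _) ∷ rows) = cong₂ (λ m n → suc (m + n)) (⊓-zeroʳ i) (Qmin-suc i rows)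
  Qmin-suc i ((suc (suc l) , _) ∷ rows) = cong suc (begin
    i ⊓ suc l + Qmin (suc i) rows                          ≡⟨ cong (_+_ (i ⊓ suc l)) (Qmin-suc i rows) ⟩
    i ⊓ suc l + (height rows + Qmin i (dropColumn rows))   ≡⟨ swap (i ⊓ suc l) (height rows) _ ⟩
    height rows + (i ⊓ suc l + Qmin i (dropColumn rows))   ∎)
    where
    open ≡-Reasoning
    swap : ∀ a b c → a + (b + c) ≡ b + (a + c)
    swap = solve-∀

  pairMin-dropColumn : ∀ xs ys →
    pairMin xs ys ≡ height xs * height ys + pairMin (dropColumn xs) (dropColumn ys)
  pairMin-dropColumn [] ys = refl
  pairMin-dropColumn ((zero , _) ∷ xs) ys =
    trans (cong (_+ pairMin xs ys) (Qmin-zero ys)) (pairMin-dropColumn xs ys)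
  pairMin-dropColumn ((suc zero , _) ∷ xs) ys =
    trans (cong₂ _+_ (trans (Qmin-suc 0 ys) (cong (height ys +_) (Qmin-zero (dropColumn ys))))
                     (pairMin-dropColumn xs ys))
          (regroup (height ys) (height xs * height ys) (pairMin (dropColumn xs) (dropColumn ys)))
    where
    regroup : ∀ a b c → a + 0 + (b + c) ≡ a + b + c
    regroup = solve-∀
  pairMin-dropColumn ((suc (suc l) , _) ∷ xs) ys =
    trans (cong₂ _+_ (Qmin-suc (suc l) ys) (pairMin-dropColumn xs ys))
          (regroup (height ys) (Qmin (suc l) (dropColumn ys)) (height xs * height ys)
                   (pairMin (dropColumn xs) (dropColumn ys)))
    where
    regroup : ∀ a q b c → a + q + (b + c) ≡ a + b + (q + c)
    regroup = solve-∀

  dropColumn-positive : ∀ rows → All PositiveRow (dropColumn rows)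
  dropColumn-positive [] = []
  dropColumn-positive ((zero , _) ∷ rows) = dropColumn-positive rows
  dropColumn-positive ((suc zero , _) ∷ rows) = dropColumn-positive rows
  dropColumn-positive ((suc (suc _) , _) ∷ rows) = s≤s z≤n ∷ dropColumn-positive rows

  dropColumn-bounded : ∀ {N} rows → All (BoundedRow (suc N)) rows → All (BoundedRow N) (dropColumn rows)
  dropColumn-bounded [] [] = []
  dropColumn-bounded ((zero , _) ∷ rows) (_ ∷ bnd) = dropColumn-bounded rows bnd
  dropColumn-bounded ((suc zero , _) ∷ rows) (_ ∷ bnd) = dropColumn-bounded rows bnd
  dropColumn-bounded ((suc (suc _) , _) ∷ rows) (s≤s i≤N ∷ bnd) = i≤N ∷ dropColumn-bounded rows bnd

  dropColumn-unrigged : ∀ rows → All UnriggedRow rows → All UnriggedRow (dropColumn rows)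
  dropColumn-unrigged [] [] = []
  dropColumn-unrigged ((zero , _) ∷ rows) (_ ∷ unr) = dropColumn-unrigged rows unr
  dropColumn-unrigged ((suc zero , _) ∷ rows) (_ ∷ unr) = dropColumn-unrigged rows unr
  dropColumn-unrigged ((suc (suc _) , _) ∷ rows) (x≡0 ∷ unr) = x≡0 ∷ dropColumn-unrigged rows unr

  length-dropColumn : ∀ rows → length (dropColumn rows) ≤ height rows
  length-dropColumn [] = z≤n
  length-dropColumn ((zero , _) ∷ rows) = length-dropColumn rows
  length-dropColumn ((suc zero , _) ∷ rows) = m≤n⇒m≤1+n (length-dropColumn rows)
  length-dropColumn ((suc (suc _) , _) ∷ rows) = s≤s (length-dropColumn rows)

  height≡0⇒[] : ∀ {rows} → All PositiveRow rows → height rows ≡ 0 → rows ≡ []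
  height≡0⇒[] [] _ = refl
  height≡0⇒[] {(suc _ , _) ∷ _} (_ ∷ _) ()

  bounded-by-0⇒[] : ∀ {rows} → All PositiveRow rows → All (BoundedRow 0) rows → rows ≡ []
  bounded-by-0⇒[] [] _ = refl
  bounded-by-0⇒[] (s≤s _ ∷ _) (() ∷ _)

  dropColumn⁻¹ : ∀ k {rows} → All PositiveRow rows → All UnriggedRow rows →
                 dropColumn rows ≡ columnsRows k (height rows) → rows ≡ columnsRows (suc k) (height rows)
  dropColumn⁻¹ k {[]} _ _ _ = refl
  dropColumn⁻¹ k {(zero , _) ∷ _} (() ∷ _) _ _
  dropColumn⁻¹ zero {(suc zero , _) ∷ rows} (_ ∷ pos) (refl ∷ unr) drop≡[] =
    cong ((1 , 0ℤ) ∷_) (dropColumn⁻¹ zero pos unr drop≡[])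
  dropColumn⁻¹ zero {(suc (suc _) , _) ∷ _} _ _ ()
  -- A row of length 1 disappears, leaving dropColumn rows shorter than the column.
  dropColumn⁻¹ (suc k) {(suc zero , _) ∷ rows} _ _ drop≡cols =
    ⊥-elim (<-irrefl refl (subst (_≤ height rows) (trans (cong length drop≡cols) (length-replicate _))
                                                  (length-dropColumn rows)))
  dropColumn⁻¹ (suc k) {(suc (suc _) , _) ∷ rows} (_ ∷ pos) (refl ∷ unr) drop≡cols
    with ∷-injective drop≡cols
  ... | refl , drop≡cols′ = cong ((suc (suc k) , 0ℤ) ∷_) (dropColumn⁻¹ (suc k) pos unr drop≡cols′)

module Excess where

  open import Data.Nat as ℕ using (ℕ; zero; suc; z≤n; s≤s)
  import Data.Nat.Properties as ℕ
  open import Data.Integer hiding (suc)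
  open import Data.Integer.Properties
  open import Data.Integer.Tactic.RingSolver using (solve-∀)
  open import Data.Vec using (lookup)
  open import Data.List using (List; map; allFin)
  open import Data.List.Properties using (map-cong)
  open import Data.List.Relation.Unary.All using (All)
  open import Data.Product using (Σ; _×_; _,_; proj₁; proj₂)
  open import Data.Sum using (_⊎_; inj₁; inj₂)
  open import Function using (_∘_)
  open import Relation.Binary.PropositionalEquality
  open import Defs
  open Sums
  open E8Form using (cartanForm; node8≤cartanForm; cartanForm≡node8⇒0⊎θ; Σnodes-δ8)
  open Columns

  AllRows : (Row → Set) → (Node → List Row) → Set
  AllRows P ν = ∀ a → All P (ν a)

  cartanPairing : (Node → List Row) → ℤ
  cartanPairing ν = Σnodes λ a → Σnodes λ b → cartan a b * + pairMin (ν a) (ν b)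

  excess : ℕ → (Node → List Row) → ℤ
  excess s ν = cartanPairing ν - + Qmin s (ν node8)

  excess-cong : ∀ s {ν μ : Node → List Row} → (∀ a → ν a ≡ μ a) → excess s ν ≡ excess s μ
  excess-cong s ν≗μ = cong₂ _-_
    (cong sumℤ (map-cong (λ a → cong sumℤ (map-cong (λ b →
      cong (λ p → cartan a b * + p) (cong₂ pairMin (ν≗μ a) (ν≗μ b))) (allFin 8))) (allFin 8)))
    (cong (λ rows → + Qmin s rows) (ν≗μ node8))

  vacancies≡-excess : ∀ s rc →
    Σnodes (λ a → sumℤ (map (λ r → vacancy s rc a (proj₁ r)) (lookup rc a))) ≡ - excess s (lookup rc)
  vacancies≡-excess s rc = begin
    Σnodes (λ a → sumℤ (map (λ r → vacancy s rc a (proj₁ r)) (ν a)))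
      ≡⟨ cong sumℤ (map-cong node-sum (allFin 8)) ⟩
    Σnodes (λ a → δ a node8 * + Qmin s (ν a) - pairing a)
      ≡⟨ sumℤ-map-- (λ a → δ a node8 * + Qmin s (ν a)) pairing (allFin 8) ⟩
    Σnodes (λ a → δ a node8 * + Qmin s (ν a)) - cartanPairing ν
      ≡⟨ cong (_- cartanPairing ν) (Σnodes-δ8 (λ a → + Qmin s (ν a))) ⟩
    + Qmin s (ν node8) - cartanPairing ν
      ≡⟨ flip-difference (+ Qmin s (ν node8)) (cartanPairing ν) ⟩
    - excess s ν ∎
    where
    open ≡-Reasoning
    ν = lookup rc
    pairing : Node → ℤ
    pairing a = Σnodes (λ b → cartan a b * + pairMin (ν a) (ν b))
    flip-difference : ∀ i j → i - j ≡ - (j - i)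
    flip-difference = solve-∀
    Qmin-pos : ∀ rows → + Qmin s rows ≡ sumℤ (map (λ r → + (proj₁ r ℕ.⊓ s)) rows)
    Qmin-pos rows = trans (pos-sum (λ r → s ℕ.⊓ proj₁ r) rows)
                          (cong sumℤ (map-cong (λ r → cong +_ (ℕ.⊓-comm s (proj₁ r))) rows))
    node-sum : ∀ a → sumℤ (map (λ r → vacancy s rc a (proj₁ r)) (ν a)) ≡ δ a node8 * + Qmin s (ν a) - pairing a
    node-sum a = begin
      sumℤ (map (λ r → vacancy s rc a (proj₁ r)) (ν a))
        ≡⟨ sumℤ-map-- (λ r → δ a node8 * + (proj₁ r ℕ.⊓ s))
                       (λ r → Σnodes (λ b → cartan a b * + Qmin (proj₁ r) (ν b))) (ν a) ⟩
      sumℤ (map (λ r → δ a node8 * + (proj₁ r ℕ.⊓ s)) (ν a))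
        - sumℤ (map (λ r → Σnodes (λ b → cartan a b * + Qmin (proj₁ r) (ν b))) (ν a))
        ≡⟨ cong₂ _-_ (trans (sumℤ-map-*ˡ (δ a node8) (λ r → + (proj₁ r ℕ.⊓ s)) (ν a))
                            (cong (δ a node8 *_) (sym (Qmin-pos (ν a)))))
                     (sumℤ-map-swap (λ r b → cartan a b * + Qmin (proj₁ r) (ν b)) (ν a) (allFin 8)) ⟩
      δ a node8 * + Qmin s (ν a) - Σnodes (λ b → sumℤ (map (λ r → cartan a b * + Qmin (proj₁ r) (ν b)) (ν a)))
        ≡⟨ cong (_-_ (δ a node8 * + Qmin s (ν a))) (cong sumℤ (map-cong (λ b →
             trans (sumℤ-map-*ˡ (cartan a b) (λ r → + Qmin (proj₁ r) (ν b)) (ν a))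
                   (cong (cartan a b *_) (sym (pos-sum (λ r → Qmin (proj₁ r) (ν b)) (ν a))))) (allFin 8))) ⟩
      δ a node8 * + Qmin s (ν a) - pairing a ∎

  cartanPairing-dropColumn : ∀ ν →
    cartanPairing ν ≡ cartanForm (λ a → + height (ν a)) + cartanPairing (dropColumn ∘ ν)
  cartanPairing-dropColumn ν = begin
    Σnodes (λ a → Σnodes (λ b → cartan a b * + pairMin (ν a) (ν b)))
      ≡⟨ cong sumℤ (map-cong (λ a → cong sumℤ (map-cong (split a) (allFin 8))) (allFin 8)) ⟩
    Σnodes (λ a → Σnodes (λ b → first a b + rest a b))
      ≡⟨ cong sumℤ (map-cong (λ a → sumℤ-map-+ (first a) (rest a) (allFin 8)) (allFin 8)) ⟩
    Σnodes (λ a → Σnodes (first a) + Σnodes (rest a))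
      ≡⟨ sumℤ-map-+ (λ a → Σnodes (first a)) (λ a → Σnodes (rest a)) (allFin 8) ⟩
    cartanForm (λ a → + h a) + cartanPairing ν′ ∎
    where
    open ≡-Reasoning
    h : Node → ℕ
    h a = height (ν a)
    ν′ : Node → List Row
    ν′ = dropColumn ∘ ν
    first rest : Node → Node → ℤ
    first a b = cartan a b * (+ h a * + h b)
    rest a b = cartan a b * + pairMin (ν′ a) (ν′ b)
    split : ∀ a b → cartan a b * + pairMin (ν a) (ν b) ≡ first a b + rest a b
    split a b = trans (cong (cartan a b *_) (begin
        + pairMin (ν a) (ν b)                        ≡⟨ cong +_ (pairMin-dropColumn (ν a) (ν b)) ⟩
        + (h a ℕ.* h b ℕ.+ pairMin (ν′ a) (ν′ b))     ≡⟨ pos-+ (h a ℕ.* h b) _ ⟩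
        + (h a ℕ.* h b) + + pairMin (ν′ a) (ν′ b)     ≡⟨ cong (_+ + pairMin (ν′ a) (ν′ b)) (pos-* (h a) (h b)) ⟩
        + h a * + h b + + pairMin (ν′ a) (ν′ b)       ∎))
      (*-distribˡ-+ (cartan a b) (+ h a * + h b) (+ pairMin (ν′ a) (ν′ b)))

  -- The share of a column of heights h: (h, h) - h₈ within the first s columns, (h, h) beyond them.
  columnExcess : ℕ → (Node → ℕ) → ℤ
  columnExcess zero h = cartanForm (λ a → + h a)
  columnExcess (suc _) h = cartanForm (λ a → + h a) - + h node8

  excess-dropColumn : ∀ s ν →
    excess s ν ≡ columnExcess s (height ∘ ν) + excess (ℕ.pred s) (dropColumn ∘ ν)
  excess-dropColumn zero ν = begin
    cartanPairing ν - + Qmin 0 (ν node8)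
      ≡⟨ cong₂ _-_ (cartanPairing-dropColumn ν) (cong +_ (Qmin-zero (ν node8))) ⟩
    q + p - + 0
      ≡⟨ regroup q p ⟩
    q + (p - + 0)
      ≡⟨ cong (λ n → q + (p - + n)) (sym (Qmin-zero (dropColumn (ν node8)))) ⟩
    columnExcess zero (height ∘ ν) + excess zero (dropColumn ∘ ν) ∎
    where
    open ≡-Reasoning
    q = cartanForm (λ a → + height (ν a))
    p = cartanPairing (dropColumn ∘ ν)
    regroup : ∀ c p → c + p - + 0 ≡ c + (p - + 0)
    regroup = solve-∀
  excess-dropColumn (suc s) ν = begin
    cartanPairing ν - + Qmin (suc s) (ν node8)
      ≡⟨ cong₂ _-_ (cartanPairing-dropColumn ν)
                   (trans (cong +_ (Qmin-suc s (ν node8))) (pos-+ (height (ν node8)) _)) ⟩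
    q + p - (+ height (ν node8) + + Qmin s (dropColumn (ν node8)))
      ≡⟨ regroup q p (+ height (ν node8)) (+ Qmin s (dropColumn (ν node8))) ⟩
    columnExcess (suc s) (height ∘ ν) + excess s (dropColumn ∘ ν) ∎
    where
    open ≡-Reasoning
    q = cartanForm (λ a → + height (ν a))
    p = cartanPairing (dropColumn ∘ ν)
    regroup : ∀ c p h q → c + p - (h + q) ≡ c - h + (p - q)
    regroup = solve-∀

  columnExcess-nonneg : ∀ s h → + 0 ≤ columnExcess s h
  columnExcess-nonneg zero h = ≤-trans (+≤+ z≤n) (node8≤cartanForm (λ a → + h a))
  columnExcess-nonneg (suc _) h = i≤j⇒0≤j-i (node8≤cartanForm (λ a → + h a))

  columnExcess-zero≡0 : ∀ h → columnExcess zero h ≡ + 0 → ∀ a → h a ≡ 0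
  columnExcess-zero≡0 h q≡0 a = +-injective (h≡0 a)
    where
    h₈≡0 : h node8 ≡ 0
    h₈≡0 = ℕ.n≤0⇒n≡0 (drop‿+≤+ (subst (+ h node8 ≤_) q≡0 (node8≤cartanForm (λ b → + h b))))
    h≡0 : ∀ b → + h b ≡ + 0
    h≡0 with cartanForm≡node8⇒0⊎θ (λ b → + h b) (trans q≡0 (cong +_ (sym h₈≡0)))
    ... | inj₁ h≡0 = h≡0
    ... | inj₂ h≡θ with trans (sym (+-injective (h≡θ node8))) h₈≡0
    ...   | ()

  columnExcess-suc≡0 : ∀ s h → columnExcess (suc s) h ≡ + 0 →
                       (∀ a → h a ≡ 0) ⊎ (∀ a → h a ≡ αcoef a)
  columnExcess-suc≡0 s h q-h₈≡0 with cartanForm≡node8⇒0⊎θ (λ a → + h a) (i-j≡0⇒i≡j _ _ q-h₈≡0)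
  ... | inj₁ h≡0 = inj₁ (λ a → +-injective (h≡0 a))
  ... | inj₂ h≡θ = inj₂ (λ a → +-injective (h≡θ a))

  excess-nonneg : ∀ N s ν → AllRows PositiveRow ν → AllRows (BoundedRow N) ν → + 0 ≤ excess s ν
  excess-nonneg zero s ν pos bnd =
    ≤-reflexive (sym (excess-cong s (λ a → bounded-by-0⇒[] (pos a) (bnd a))))
  excess-nonneg (suc N) s ν pos bnd = subst (+ 0 ≤_) (sym (excess-dropColumn s ν))
    (+-mono-≤ (columnExcess-nonneg s (height ∘ ν))
              (excess-nonneg N (ℕ.pred s) (dropColumn ∘ ν) (dropColumn-positive ∘ ν)
                             (λ a → dropColumn-bounded (ν a) (bnd a))))

  Columns : ℕ → (Node → List Row) → Set
  Columns s ν = Σ ℕ λ k → k ℕ.≤ s × (∀ a → ν a ≡ columnsRows k (αcoef a))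

  excess≡0⇒columns : ∀ N s ν → AllRows PositiveRow ν → AllRows (BoundedRow N) ν →
                     AllRows UnriggedRow ν → excess s ν ≡ + 0 → Columns s ν
  excess≡0⇒columns zero s ν pos bnd unr _ = 0 , z≤n , λ a → bounded-by-0⇒[] (pos a) (bnd a)
  excess≡0⇒columns (suc N) s ν pos bnd unr excess≡0 = from-first-column s (proj₁ split) (proj₂ split)
    where
    ν′ : Node → List Row
    ν′ = dropColumn ∘ ν
    pos′ : AllRows PositiveRow ν′
    pos′ = dropColumn-positive ∘ ν
    bnd′ : AllRows (BoundedRow N) ν′
    bnd′ a = dropColumn-bounded (ν a) (bnd a)
    unr′ : AllRows UnriggedRow ν′
    unr′ a = dropColumn-unrigged (ν a) (unr a)
    split : columnExcess s (height ∘ ν) ≡ + 0 × excess (ℕ.pred s) ν′ ≡ + 0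
    split = nonneg-+≡0 (columnExcess-nonneg s (height ∘ ν)) (excess-nonneg N (ℕ.pred s) ν′ pos′ bnd′)
                       (trans (sym (excess-dropColumn s ν)) excess≡0)
    empty : ∀ {s} → (∀ a → height (ν a) ≡ 0) → Columns s ν
    empty height≡0 = 0 , z≤n , λ a → height≡0⇒[] (pos a) (height≡0 a)
    stack : ∀ {s} → (∀ a → height (ν a) ≡ αcoef a) → Columns s ν′ → Columns (suc s) ν
    stack height≡θ (k , k≤s , ν′≡columns) = suc k , s≤s k≤s , λ a →
      subst (λ c → ν a ≡ columnsRows (suc k) c) (height≡θ a)
        (dropColumn⁻¹ k (pos a) (unr a)
          (subst (λ c → ν′ a ≡ columnsRows k c) (sym (height≡θ a)) (ν′≡columns a)))
    from-first-column : ∀ s → columnExcess s (height ∘ ν) ≡ + 0 → excess (ℕ.pred s) ν′ ≡ + 0 →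
                        Columns s ν
    from-first-column zero column≡0 _ = empty (columnExcess-zero≡0 (height ∘ ν) column≡0)
    from-first-column (suc s) column≡0 rest≡0 with columnExcess-suc≡0 s (height ∘ ν) column≡0
    ... | inj₁ height≡0 = empty height≡0
    ... | inj₂ height≡θ = stack height≡θ (excess≡0⇒columns N s ν′ pos′ bnd′ unr′ rest≡0)

module Configurations where

  open import Data.Nat as ℕ using (ℕ; zero; suc; z≤n; s≤s; _⊓_)
  import Data.Nat.Properties as ℕ
  open import Data.Nat.DivMod using (m*n/n≡m)
  open import Data.Integer hiding (suc; _⊓_)
  open import Data.Integer.Properties
  open import Data.Integer.Tactic.RingSolver using (solve-∀)
  open import Data.Integer.Solver using (module +-*-Solver)
  open +-*-Solver using (solve; _:=_; _:*_; con)
  open import Data.Vec using (lookup)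
  open import Data.Vec.Properties using (lookup∘tabulate; tabulate-cong)
  open import Data.List using ([]; _∷_; map; replicate; allFin)
  open import Data.List.Properties using (map-cong)
  open import Data.List.Relation.Unary.All using (All; []; _∷_)
  open import Data.List.Relation.Unary.All.Properties using (replicate⁺)
  open import Data.List.Relation.Unary.Linked using (Linked; []; [-]; _∷_)
  open import Data.Product using (_×_; _,_; proj₂)
  open import Data.Sum using (inj₂)
  open import Relation.Binary.PropositionalEquality
  open import Defs
  open Sums
  open E8Form using (ΣnodesS; cartan-θ)

  lookup-νkα : ∀ k a → lookup (νkα k) a ≡ columnsRows k (αcoef a)
  lookup-νkα k = lookup∘tabulate (λ a → columnsRows k (αcoef a))

  Qmin-columnsRows : ∀ i k c → Qmin i (columnsRows k c) ≡ c ℕ.* (i ⊓ k)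
  Qmin-columnsRows i zero c = sym (trans (cong (c ℕ.*_) (ℕ.⊓-zeroʳ i)) (ℕ.*-zeroʳ c))
  Qmin-columnsRows i (suc k) zero = refl
  Qmin-columnsRows i (suc k) (suc c) = cong (i ⊓ suc k ℕ.+_) (Qmin-columnsRows i (suc k) c)

  pairMin-columnsRows : ∀ k c d → pairMin (columnsRows k c) (columnsRows k d) ≡ c ℕ.* (d ℕ.* k)
  pairMin-columnsRows zero c d = sym (trans (cong (c ℕ.*_) (ℕ.*-zeroʳ d)) (ℕ.*-zeroʳ c))
  pairMin-columnsRows (suc k) zero d = refl
  pairMin-columnsRows (suc k) (suc c) d = cong₂ ℕ._+_
    (trans (Qmin-columnsRows (suc k) (suc k) d) (cong (d ℕ.*_) (ℕ.⊓-idem (suc k))))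
    (pairMin-columnsRows (suc k) c d)

  size-columnsRows : ∀ k c → size (columnsRows k c) ≡ c ℕ.* k
  size-columnsRows zero c = sym (ℕ.*-zeroʳ c)
  size-columnsRows (suc k) zero = refl
  size-columnsRows (suc k) (suc c) = cong (suc k ℕ.+_) (size-columnsRows (suc k) c)

  riggings-columnsRows : ∀ k c → sumℤ (map proj₂ (columnsRows k c)) ≡ + 0
  riggings-columnsRows zero c = refl
  riggings-columnsRows (suc k) zero = refl
  riggings-columnsRows (suc k) (suc c) = trans (+-identityˡ _) (riggings-columnsRows (suc k) c)

  Σcartan-θ : ∀ a K → Σnodes (λ b → cartan a b * (+ αcoef b * K)) ≡ δ a node8 * K
  Σcartan-θ a K = begin
    Σnodes (λ b → cartan a b * (+ αcoef b * K))
      ≡⟨ cong sumℤ (map-cong (λ b → sym (*-assoc (cartan a b) (+ αcoef b) K)) (allFin 8)) ⟩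
    Σnodes (λ b → cartan a b * + αcoef b * K)
      ≡⟨ sumℤ-map-*ʳ K (λ b → cartan a b * + αcoef b) (allFin 8) ⟩
    Σnodes (λ b → cartan a b * + αcoef b) * K
      ≡⟨ cong (_* K) (cartan-θ a) ⟩
    δ a node8 * K ∎
    where open ≡-Reasoning

  vacancy-νkα : ∀ s k a → k ℕ.≤ s → vacancy s (νkα k) a k ≡ + 0
  vacancy-νkα s k a k≤s = i≡j⇒i-j≡0 (begin
    δ a node8 * + (k ⊓ s)                                    ≡⟨ cong (λ n → δ a node8 * + n) (ℕ.m≤n⇒m⊓n≡m k≤s) ⟩
    δ a node8 * + k                                          ≡⟨ Σcartan-θ a (+ k) ⟨
    Σnodes (λ b → cartan a b * (+ αcoef b * + k))            ≡⟨ cong sumℤ (map-cong Qmin-term (allFin 8)) ⟩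
    Σnodes (λ b → cartan a b * + Qmin k (lookup (νkα k) b))  ∎)
    where
    open ≡-Reasoning
    Qmin-term : ∀ b → cartan a b * (+ αcoef b * + k) ≡ cartan a b * + Qmin k (lookup (νkα k) b)
    Qmin-term b = cong (cartan a b *_) (sym (begin
      + Qmin k (lookup (νkα k) b)         ≡⟨ cong (λ rows → + Qmin k rows) (lookup-νkα k b) ⟩
      + Qmin k (columnsRows k (αcoef b))  ≡⟨ cong +_ (Qmin-columnsRows k k (αcoef b)) ⟩
      + (αcoef b ℕ.* (k ⊓ k))             ≡⟨ cong (λ n → + (αcoef b ℕ.* n)) (ℕ.⊓-idem k) ⟩
      + (αcoef b ℕ.* k)                   ≡⟨ pos-* (αcoef b) k ⟩
      + αcoef b * + k                     ∎))

  νkα-highestWeight : ∀ s k → k ℕ.≤ s → IsHWRC s (νkα k)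
  νkα-highestWeight s zero _ a = subst (All _) (sym (lookup-νkα zero a)) []
  νkα-highestWeight s (suc k) k≤s a = subst (All _) (sym (lookup-νkα (suc k) a))
    (replicate⁺ (αcoef a) (≤-refl , ≤-reflexive (sym (vacancy-νkα s (suc k) a k≤s))))

  linked-replicate : ∀ {R : Row → Row → Set} {x} c → R x x → Linked R (replicate c x)
  linked-replicate zero _ = []
  linked-replicate (suc zero) _ = [-]
  linked-replicate (suc (suc c)) Rxx = Rxx ∷ linked-replicate (suc c) Rxx

  νkα-canonical : ∀ k → Canonical (νkα k)
  νkα-canonical zero a =
    subst (λ rows → All _ rows × Linked RowGeq rows) (sym (lookup-νkα zero a)) ([] , [])
  νkα-canonical (suc k) a = subst (λ rows → All _ rows × Linked RowGeq rows) (sym (lookup-νkα (suc k) a))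
    (replicate⁺ (αcoef a) (s≤s z≤n) , linked-replicate (αcoef a) (inj₂ (refl , ≤-refl)))

  weight-νkα : ∀ s k → k ℕ.≤ s → weight s (νkα k) ≡ nΛ8 (s ℕ.∸ k)
  weight-νkα s k k≤s = tabulate-cong λ b → begin
    δ b node8 * + s - Σnodes (λ a → cartan b a * + size (lookup (νkα k) a))
      ≡⟨ cong (_-_ (δ b node8 * + s)) (trans (cong sumℤ (map-cong (size-term b) (allFin 8)))
                                              (Σcartan-θ b (+ k))) ⟩
    δ b node8 * + s - δ b node8 * + k
      ≡⟨ factor (δ b node8) (+ s) (+ k) ⟩
    δ b node8 * (+ s - + k)
      ≡⟨ cong (δ b node8 *_) (trans (m-n≡m⊖n s k) (⊖-≥ k≤s)) ⟩
    δ b node8 * + (s ℕ.∸ k) ∎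
    where
    open ≡-Reasoning
    factor : ∀ d i j → d * i - d * j ≡ d * (i - j)
    factor = solve-∀
    size-term : ∀ b a → cartan b a * + size (lookup (νkα k) a) ≡ cartan b a * (+ αcoef a * + k)
    size-term b a = cong (cartan b a *_) (begin
      + size (lookup (νkα k) a)         ≡⟨ cong (λ rows → + size rows) (lookup-νkα k a) ⟩
      + size (columnsRows k (αcoef a))  ≡⟨ cong +_ (size-columnsRows k (αcoef a)) ⟩
      + (αcoef a ℕ.* k)                 ≡⟨ pos-* (αcoef a) k ⟩
      + αcoef a * + k                   ∎)

  cartanForm-θ : ∀ K → Σnodes (λ a → Σnodes (λ b → cartan a b * (+ αcoef a * (+ αcoef b * K)))) ≡ + 2 * K
  cartanForm-θ = solve 1 (λ K → ΣnodesS (λ a → ΣnodesS (λ b →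
    con (cartan a b) :* (con (+ αcoef a) :* (con (+ αcoef b) :* K)))) := con (+ 2) :* K) refl

  cocharge-νkα : ∀ k → cocharge (νkα k) ≡ + k
  cocharge-νkα k = trans (cong₂ _+_ quadratic riggings) (+-identityʳ (+ k))
    where
    open ≡-Reasoning
    ν = lookup (νkα k)
    pairMin-term : ∀ a b →
      cartan a b * + pairMin (ν a) (ν b) ≡ cartan a b * (+ αcoef a * (+ αcoef b * + k))
    pairMin-term a b = cong (cartan a b *_) (begin
      + pairMin (ν a) (ν b)
        ≡⟨ cong₂ (λ xs ys → + pairMin xs ys) (lookup-νkα k a) (lookup-νkα k b) ⟩
      + pairMin (columnsRows k (αcoef a)) (columnsRows k (αcoef b))
        ≡⟨ cong +_ (pairMin-columnsRows k (αcoef a) (αcoef b)) ⟩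
      + (αcoef a ℕ.* (αcoef b ℕ.* k))
        ≡⟨ trans (pos-* (αcoef a) _) (cong (+ αcoef a *_) (pos-* (αcoef b) k)) ⟩
      + αcoef a * (+ αcoef b * + k) ∎)
    quadratic : Σnodes (λ a → Σnodes (λ b → cartan a b * + pairMin (ν a) (ν b))) /ℕ 2 ≡ + k
    quadratic = begin
      Σnodes (λ a → Σnodes (λ b → cartan a b * + pairMin (ν a) (ν b))) /ℕ 2
        ≡⟨ cong (_/ℕ 2) (cong sumℤ (map-cong (λ a →
             cong sumℤ (map-cong (pairMin-term a) (allFin 8))) (allFin 8))) ⟩
      Σnodes (λ a → Σnodes (λ b → cartan a b * (+ αcoef a * (+ αcoef b * + k)))) /ℕ 2
        ≡⟨ cong (_/ℕ 2) (trans (cartanForm-θ (+ k)) (sym (pos-* 2 k))) ⟩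
      + (2 ℕ.* k) /ℕ 2
        ≡⟨ cong +_ (trans (cong (ℕ._/ 2) (ℕ.*-comm 2 k)) (m*n/n≡m k 2)) ⟩
      + k ∎
    riggings : Σnodes (λ a → sumℤ (map proj₂ (ν a))) ≡ + 0
    riggings = cong sumℤ (map-cong (λ a → trans (cong (λ rows → sumℤ (map proj₂ rows)) (lookup-νkα k a))
                                               (riggings-columnsRows k (αcoef a))) (allFin 8))

module HighestWeight where

  open import Data.Nat as ℕ using (ℕ)
  import Data.Nat.Properties as ℕ
  open import Data.Integer hiding (suc)
  open import Data.Integer.Properties
  open import Data.Vec using (lookup)
  open import Data.Vec.Properties using (tabulate∘lookup; tabulate-cong)
  open import Data.List using (List; map; foldr; allFin)
  open import Data.List.Membership.Propositional.Properties using (∈-allFin)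
  open import Data.List.Relation.Unary.All as All using (All)
  open import Data.Product using (Σ; _×_; _,_; proj₁; proj₂)
  open import Relation.Binary.PropositionalEquality
  open import Defs
  open Sums
  open Columns using (BoundedRow; PositiveRow; UnriggedRow)
  open Excess

  totalSize : (Node → List Row) → ℕ
  totalSize ν = foldr ℕ._+_ 0 (map (λ a → size (ν a)) (allFin 8))

  rows-bounded : ∀ ν → AllRows (BoundedRow (totalSize ν)) ν
  rows-bounded ν a = All.tabulate λ r∈νa →
    ℕ.≤-trans (∈⇒≤sum proj₁ r∈νa) (∈⇒≤sum (λ b → size (ν b)) (∈-allFin a))

  module _ (s : ℕ) (rc : RC) (canonical : Canonical rc) (hw : IsHWRC s rc) where

    private
      ν : Node → List Row
      ν = lookup rc

      rows-positive : AllRows PositiveRow ν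
      rows-positive a = proj₁ (canonical a)

      riggings : Node → ℤ
      riggings a = sumℤ (map proj₂ (ν a))

      riggings-nonneg : ∀ a → + 0 ≤ riggings a
      riggings-nonneg a = sumℤ-map-nonneg (All.map proj₁ (hw a))

      Σriggings-nonneg : + 0 ≤ Σnodes riggings
      Σriggings-nonneg = sumℤ-map-nonneg (All.universal riggings-nonneg (allFin 8))

      Σriggings≤-excess : Σnodes riggings ≤ - excess s ν
      Σriggings≤-excess = subst (Σnodes riggings ≤_) (vacancies≡-excess s rc)
        (sumℤ-map-mono (All.universal (λ a → sumℤ-map-mono (All.map proj₂ (hw a))) (allFin 8)))

      excess≡0 : excess s ν ≡ + 0
      excess≡0 = ≤-antisym (neg-cancel-≤ {+ 0} {excess s ν} (≤-trans Σriggings-nonneg Σriggings≤-excess))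
                           (excess-nonneg (totalSize ν) s ν rows-positive (rows-bounded ν))

      Σriggings≡0 : Σnodes riggings ≡ + 0
      Σriggings≡0 =
        ≤-antisym (subst (Σnodes riggings ≤_) (cong -_ excess≡0) Σriggings≤-excess) Σriggings-nonneg

      rows-unrigged : AllRows UnriggedRow ν
      rows-unrigged a = sumℤ-map≡0 (All.map proj₁ (hw a))
        (All.lookup (sumℤ-map≡0 (All.universal riggings-nonneg (allFin 8)) Σriggings≡0) (∈-allFin a))

      to-νkα : Columns s ν → Σ ℕ (λ k → k ℕ.≤ s × rc ≡ νkα k)
      to-νkα (k , k≤s , ν≡columns) = k , k≤s , trans (sym (tabulate∘lookup rc)) (tabulate-cong ν≡columns)

    highestWeight⇒columns : Σ ℕ (λ k → k ℕ.≤ s × rc ≡ νkα k)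
    highestWeight⇒columns =
      to-νkα (excess≡0⇒columns (totalSize ν) s ν rows-positive (rows-bounded ν) rows-unrigged excess≡0)

open import Defs
open import Data.Nat using (ℕ; _≤_; _∸_)
open import Data.Integer using (+_)
open import Data.Product using (_×_; Σ; _,_)
open import Relation.Binary.PropositionalEquality using (_≡_; refl)
open HighestWeight using (highestWeight⇒columns)
open Configurations using (νkα-highestWeight; νkα-canonical; weight-νkα; cocharge-νkα)

proposition9p21 : (s : ℕ) → 1 ≤ s →
    ((rc : RC) → Canonical rc →
       (IsHWRC s rc → Σ ℕ (λ k → (k ≤ s) × (rc ≡ νkα k)))
       × ((Σ ℕ (λ k → (k ≤ s) × (rc ≡ νkα k))) → IsHWRC s rc))
    × ((k : ℕ) → k ≤ s →
       Canonical (νkα k)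
       × (weight s (νkα k) ≡ nΛ8 (s ∸ k))
       × (cocharge (νkα k) ≡ + k))
proposition9p21 s _ =
  (λ rc canonical → highestWeight⇒columns s rc canonical , columns⇒highestWeight) ,
  (λ k k≤s → νkα-canonical k , weight-νkα s k k≤s , cocharge-νkα k)
  where
  columns⇒highestWeight : ∀ {rc} → Σ ℕ (λ k → (k ≤ s) × (rc ≡ νkα k)) → IsHWRC s rc
  columns⇒highestWeight (k , k≤s , refl) = νkα-highestWeight s k k≤s
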